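{- Let $n\ge 1$, let $S={a_1 \choose b_1},\dots,{a_n \choose b_n}$ be a sequence of pairs of nonnegative integers, and let $\sigma$ be a permutation of $\{1,\dots,n\}$. Define $X_\sigma(0):=0$ and, for $k\in\{1,\dots,n\}$, $$X_{\sigma}(k):=\sum_{i=1}^{k}\min(b_{\sigma(i)},k-1)+\sum_{i=k+1}^{n}\min(b_{\sigma(i)},k).$$ Then for all $k,k'\in\{1,\dots,n\}$ with $k'>k$, $$X_{\sigma}(k')-X_{\sigma}(k'-1)\le X_{\sigma}(k)-X_{\sigma}(k-1)+1.$$ Moreover, if for some $k\ge 2$ we have $X_{\sigma}(k)-X_{\sigma}(k-1)=X_{\sigma}(k-1)-X_{\sigma}(k-2)+1$, then for all $k'\in\{1,\dots,n\}$ with $k'>k$, $$X_{\sigma}(k')-X_{\sigma}(k'-1)\le X_{\sigma}(k)-X_{\sigma}(k-1).$$ -}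

module Defs where

open import Data.Nat using (ℕ; zero; suc; _<ᵇ_; _⊓_; _∸_)
open import Data.Bool using (if_then_else_)
open import Data.Fin using (Fin; toℕ)
open import Data.Fin.Permutation using (Permutation′; _⟨$⟩ʳ_)
open import Data.List using (map; allFin)
open import Data.Nat.ListAction using (sum)
open import Data.Integer using (ℤ; +_; _-_)
open import Data.Product using (_×_)

-- A sequence S of n pairs (a_i, b_i); only the b-components matter for X.
-- Positions and the permutation are 0-based: position j ∈ Fin n corresponds
-- to the paper's index i = j + 1.

Xterm : ℕ → ℕ → ℕ → ℕ
Xterm k j bv = if j <ᵇ k then bv ⊓ (k ∸ 1) else bv ⊓ k

X : {n : ℕ} → (Fin n → ℕ × ℕ) → Permutation′ n → ℕ → ℕ
X S σ zero = 0
X {n} S σ (suc k) =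
  sum (map (λ j → Xterm (suc k) (toℕ j) (proj₂ (S (σ ⟨$⟩ʳ j)))) (allFin n))
  where open import Data.Product using (proj₂)

ΔX : {n : ℕ} → (Fin n → ℕ × ℕ) → Permutation′ n → ℕ → ℤ
ΔX S σ k = + X S σ k - + X S σ (k ∸ 1)

-- Write X_σ(k) = Σ_j min(b_j, cap k j), where the cap is k - 1 for positions j < k and k
-- otherwise. Passing from k to k + 1 raises every cap by one except the one at position k.
-- Hence the increment Δ k = X_σ(k+1) - X_σ(k) satisfies rises k - 1 ≤ Δ k ≤ rises k, where
-- rises k counts the entries strictly above their cap. Caps only grow with k, so rises is
-- non-increasing. A later increment is therefore at most rises k ≤ Δ k + 1; and a jump
-- Δ (c+1) = Δ c + 1 forces Δ (c+1) = rises (c+1), which bounds every later increment.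
module Submission where

open import Defs
open import Data.Nat using (ℕ; _≤_; _<_; _∸_)
open import Data.Product using (_×_)
open import Data.Fin using (Fin)
open import Data.Fin.Permutation using (Permutation′)
open import Data.Integer using (ℤ; +_; _+_; _-_) renaming (_≤_ to _≤ℤ_)
open import Relation.Binary.PropositionalEquality using (_≡_)

open import Data.Nat as ℕ using (zero; suc; pred; _⊓_; _<ᵇ_; z≤n; s≤s; s≤s⁻¹; >-nonZero)
open import Data.Nat.Properties
open import Data.Bool using (true; false; if_then_else_)
import Data.Nat.ListAction as List
open import Algebra.Properties.CommutativeMonoid.Sum +-0-commutativeMonoid
  using (sum-syntax; sum-cong-≗; sum-replicate-zero; ∑-distrib-+)
open import Data.Fin as Fin using (toℕ)
open import Data.Fin.Permutation using (_⟨$⟩ʳ_)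
open import Data.Integer using (_⊖_; +≤+)
open import Data.Integer.Properties using ([+m]-[+n]≡m⊖n; ⊖-≥; +-injective)
open import Data.List using (tabulate; map; allFin)
open import Data.List.Properties using (map-tabulate)
open import Data.Product using (_,_; proj₂)
open import Function using (_∘_; id)
open import Relation.Binary using (tri<; tri≈; tri>)
open import Relation.Binary.PropositionalEquality
  using (_≢_; refl; sym; trans; cong; cong₂; subst₂; module ≡-Reasoning)
open import Relation.Nullary using (yes; no; contradiction; ofʸ; ofⁿ)

sum-tabulate : ∀ {n} (g : Fin n → ℕ) → List.sum (tabulate g) ≡ ∑[ j < n ] g j
sum-tabulate {zero} g = refl
sum-tabulate {suc n} g = cong (g Fin.zero ℕ.+_) (sum-tabulate (g ∘ Fin.suc))

∑-mono-≤ : ∀ {n} {u v : Fin n → ℕ} → (∀ j → u j ≤ v j) → ∑[ j < n ] u j ≤ ∑[ j < n ] v j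
∑-mono-≤ {zero} u≤v = z≤n
∑-mono-≤ {suc n} u≤v = +-mono-≤ (u≤v Fin.zero) (∑-mono-≤ (u≤v ∘ Fin.suc))

∑-mono-≤-except-at : ∀ {n} {u v : Fin n → ℕ} a →
  (∀ j → toℕ j ≢ a → u j ≤ v j) → (∀ j → u j ≤ suc (v j)) →
  ∑[ j < n ] u j ≤ suc (∑[ j < n ] v j)
∑-mono-≤-except-at {zero} a _ _ = z≤n
∑-mono-≤-except-at {suc n} zero u≤v u≤1+v =
  +-mono-≤ (u≤1+v Fin.zero) (∑-mono-≤ (λ j → u≤v (Fin.suc j) λ ()))
∑-mono-≤-except-at {suc n} {u} {v} (suc a) u≤v u≤1+v = begin
  u Fin.zero ℕ.+ ∑[ j < n ] u (Fin.suc j)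
    ≤⟨ +-mono-≤ (u≤v Fin.zero λ ())
                (∑-mono-≤-except-at a (λ j j≢a → u≤v (Fin.suc j) (j≢a ∘ suc-injective))
                                      (u≤1+v ∘ Fin.suc)) ⟩
  v Fin.zero ℕ.+ suc (∑[ j < n ] v (Fin.suc j))
    ≡⟨ +-suc _ _ ⟩
  suc (∑[ j < suc n ] v j) ∎
  where open ≤-Reasoning

𝟙[_<_] : ℕ → ℕ → ℕ
𝟙[ _ < zero ] = 0
𝟙[ zero < suc _ ] = 1
𝟙[ suc m < suc b ] = 𝟙[ m < b ]

𝟙[<]-antitone : ∀ {m m′} b → m ≤ m′ → 𝟙[ m′ < b ] ≤ 𝟙[ m < b ]
𝟙[<]-antitone zero _ = z≤n
𝟙[<]-antitone {zero} {zero} (suc b) _ = ≤-refl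
𝟙[<]-antitone {zero} {suc m′} (suc b) _ = 𝟙[<]≤1 m′ b
  where
  𝟙[<]≤1 : ∀ m b → 𝟙[ m < b ] ≤ 1
  𝟙[<]≤1 _ zero = z≤n
  𝟙[<]≤1 zero (suc b) = ≤-refl
  𝟙[<]≤1 (suc m) (suc b) = 𝟙[<]≤1 m b
𝟙[<]-antitone {suc m} {suc m′} (suc b) (s≤s m≤m′) = 𝟙[<]-antitone b m≤m′

⊓-suc : ∀ b m → b ⊓ suc m ≡ b ⊓ m ℕ.+ 𝟙[ m < b ]
⊓-suc zero m = refl
⊓-suc (suc b) zero = cong suc (⊓-zeroʳ b)
⊓-suc (suc b) (suc m) = cong suc (⊓-suc b m)

⊓-suc-≤ : ∀ b m → b ⊓ suc m ≤ suc (b ⊓ m)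
⊓-suc-≤ b m = ⊓-monoˡ-≤ (suc m) (n≤1+n b)

cap : ℕ → ℕ → ℕ
cap k j = if j <ᵇ k then pred k else k

Xterm≡⊓cap : ∀ k j b → Xterm k j b ≡ b ⊓ cap k j
Xterm≡⊓cap k j b with j <ᵇ k
... | true = refl
... | false = refl

cap-< : ∀ {j k} → j < k → cap k j ≡ pred k
cap-< {j} {k} j<k with j <ᵇ k | <ᵇ-reflects-< j k
... | true | _ = refl
... | false | ofⁿ j≮k = contradiction j<k j≮k

cap-≥ : ∀ {j k} → k ≤ j → cap k j ≡ k
cap-≥ {j} {k} k≤j with j <ᵇ k | <ᵇ-reflects-< j k
... | true | ofʸ j<k = contradiction k≤j (<⇒≱ j<k)
... | false | _ = refl

cap-suc-self : ∀ k → cap (suc k) k ≡ cap k k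
cap-suc-self k = trans (cap-< (n<1+n k)) (sym (cap-≥ ≤-refl))

cap-suc-≢ : ∀ {j k} → j ≢ k → cap (suc k) j ≡ suc (cap k j)
cap-suc-≢ {j} {k} j≢k with <-cmp j k
... | tri< j<k _ _ = begin
  cap (suc k) j      ≡⟨ cap-< (m<n⇒m<1+n j<k) ⟩
  k                  ≡⟨ suc-pred k {{>-nonZero (≤-<-trans z≤n j<k)}} ⟨
  suc (pred k)       ≡⟨ cong suc (cap-< j<k) ⟨
  suc (cap k j)      ∎
  where open ≡-Reasoning
... | tri≈ _ j≡k _ = contradiction j≡k j≢k
... | tri> _ _ k<j = trans (cap-≥ k<j) (cong suc (sym (cap-≥ (<⇒≤ k<j))))

cap-≤-suc : ∀ k j → cap k j ≤ cap (suc k) j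
cap-≤-suc k j with j ≟ k
... | yes refl = ≤-reflexive (sym (cap-suc-self k))
... | no j≢k = ≤-trans (n≤1+n (cap k j)) (≤-reflexive (sym (cap-suc-≢ j≢k)))

cap-suc-≤ : ∀ k j → cap (suc k) j ≤ suc (cap k j)
cap-suc-≤ k j with j ≟ k
... | yes refl = ≤-trans (≤-reflexive (cap-suc-self k)) (n≤1+n (cap k k))
... | no j≢k = ≤-reflexive (cap-suc-≢ j≢k)

module WithinOneOfAntitone {Y f : ℕ → ℕ}
  (Y≤f : ∀ a → Y a ≤ f a) (f≤Y+1 : ∀ a → f a ≤ Y a ℕ.+ 1) (f-suc-≤ : ∀ a → f (suc a) ≤ f a)
  where

  f-antitone : ∀ {a a′} → a ≤ a′ → f a′ ≤ f a
  f-antitone {a′ = zero} z≤n = ≤-refl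
  f-antitone {a} {suc a′} a≤1+a′ with a ≟ suc a′
  ... | yes refl = ≤-refl
  ... | no a≢1+a′ = ≤-trans (f-suc-≤ a′) (f-antitone (s≤s⁻¹ (≤∧≢⇒< a≤1+a′ a≢1+a′)))

  later-≤-earlier+1 : ∀ {a a′} → a ≤ a′ → Y a′ ≤ Y a ℕ.+ 1
  later-≤-earlier+1 {a} {a′} a≤a′ = ≤-trans (Y≤f a′) (≤-trans (f-antitone a≤a′) (f≤Y+1 a))

  later-≤-after-jump : ∀ {c a′} → Y (suc c) ≡ Y c ℕ.+ 1 → suc c ≤ a′ → Y a′ ≤ Y (suc c)
  later-≤-after-jump {c} {a′} jump c<a′ = begin
    Y a′          ≤⟨ Y≤f a′ ⟩
    f a′          ≤⟨ f-antitone c<a′ ⟩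
    f (suc c)     ≤⟨ f-suc-≤ c ⟩
    f c           ≤⟨ f≤Y+1 c ⟩
    Y c ℕ.+ 1     ≡⟨ jump ⟨
    Y (suc c)     ∎
    where open ≤-Reasoning

module CappedSums {n : ℕ} (b : Fin n → ℕ) where

  ∑min : (ℕ → ℕ) → ℕ
  ∑min c = ∑[ j < n ] (b j ⊓ c (toℕ j))

  count< : (ℕ → ℕ) → ℕ
  count< c = ∑[ j < n ] 𝟙[ c (toℕ j) < b j ]

  ∑min-suc : ∀ c → ∑min (suc ∘ c) ≡ ∑min c ℕ.+ count< c
  ∑min-suc c = trans (sum-cong-≗ (λ j → ⊓-suc (b j) (c (toℕ j))))
    (∑-distrib-+ (λ j → b j ⊓ c (toℕ j)) (λ j → 𝟙[ c (toℕ j) < b j ]))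

  ∑min-mono : ∀ {c c′} → (∀ i → c i ≤ c′ i) → ∑min c ≤ ∑min c′
  ∑min-mono c≤c′ = ∑-mono-≤ (λ j → ⊓-monoʳ-≤ (b j) (c≤c′ (toℕ j)))

  count<-antitone : ∀ {c c′} → (∀ i → c i ≤ c′ i) → count< c′ ≤ count< c
  count<-antitone c≤c′ = ∑-mono-≤ (λ j → 𝟙[<]-antitone (b j) (c≤c′ (toℕ j)))

  Xcap : ℕ → ℕ
  Xcap k = ∑min (cap k)

  Δ : ℕ → ℕ
  Δ k = Xcap (suc k) ∸ Xcap k

  rises : ℕ → ℕ
  rises k = count< (cap k)

  Xcap-≤-Xcap-suc : ∀ k → Xcap k ≤ Xcap (suc k)
  Xcap-≤-Xcap-suc k = ∑min-mono (cap-≤-suc k)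

  Xcap-suc-≤-Xcap+rises : ∀ k → Xcap (suc k) ≤ Xcap k ℕ.+ rises k
  Xcap-suc-≤-Xcap+rises k = ≤-trans (∑min-mono (cap-suc-≤ k)) (≤-reflexive (∑min-suc (cap k)))

  Xcap+rises-≤-1+Xcap-suc : ∀ k → Xcap k ℕ.+ rises k ≤ suc (Xcap (suc k))
  Xcap+rises-≤-1+Xcap-suc k = ≤-trans (≤-reflexive (sym (∑min-suc (cap k))))
    (∑-mono-≤-except-at k
      (λ j j≢k → ≤-reflexive (cong (b j ⊓_) (sym (cap-suc-≢ j≢k))))
      (λ j → ≤-trans (⊓-suc-≤ (b j) (cap k (toℕ j))) (s≤s (⊓-monoʳ-≤ (b j) (cap-≤-suc k (toℕ j))))))

  Δ≤rises : ∀ k → Δ k ≤ rises k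
  Δ≤rises k = m≤n+o⇒m∸n≤o (Xcap (suc k)) (Xcap k) (Xcap-suc-≤-Xcap+rises k)

  rises≤Δ+1 : ∀ k → rises k ≤ Δ k ℕ.+ 1
  rises≤Δ+1 k = begin
    rises k                          ≤⟨ m+n≤o⇒m≤o∸n (rises k) rises+Xcap-≤ ⟩
    (Xcap (suc k) ℕ.+ 1) ∸ Xcap k    ≡⟨ +-∸-comm 1 (Xcap-≤-Xcap-suc k) ⟩
    Δ k ℕ.+ 1                        ∎
    where
    open ≤-Reasoning
    rises+Xcap-≤ : rises k ℕ.+ Xcap k ≤ Xcap (suc k) ℕ.+ 1
    rises+Xcap-≤ = subst₂ _≤_ (+-comm (Xcap k) (rises k)) (+-comm 1 (Xcap (suc k))) (Xcap+rises-≤-1+Xcap-suc k)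

  rises-suc-≤ : ∀ k → rises (suc k) ≤ rises k
  rises-suc-≤ k = count<-antitone (cap-≤-suc k)

  open WithinOneOfAntitone Δ≤rises rises≤Δ+1 rises-suc-≤ public

module _ {n : ℕ} (S : Fin n → ℕ × ℕ) (σ : Permutation′ n) where

  open CappedSums (proj₂ ∘ S ∘ (σ ⟨$⟩ʳ_))

  X≡Xcap : ∀ k → X S σ k ≡ Xcap k
  X≡Xcap zero = sym (trans (sum-cong-≗ (λ j → ⊓-zeroʳ (proj₂ (S (σ ⟨$⟩ʳ j))))) (sum-replicate-zero n))
  X≡Xcap (suc k) = begin
    List.sum (map g (allFin n))  ≡⟨ cong List.sum (map-tabulate id g) ⟩
    List.sum (tabulate g)        ≡⟨ sum-tabulate g ⟩
    ∑[ j < n ] g j               ≡⟨ sum-cong-≗ (λ j → Xterm≡⊓cap (suc k) (toℕ j) (proj₂ (S (σ ⟨$⟩ʳ j)))) ⟩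
    Xcap (suc k)                 ∎
    where
    open ≡-Reasoning
    g : Fin n → ℕ
    g j = Xterm (suc k) (toℕ j) (proj₂ (S (σ ⟨$⟩ʳ j)))

  ΔX-suc : ∀ k → ΔX S σ (suc k) ≡ + Δ k
  ΔX-suc k = begin
    + X S σ (suc k) - + X S σ k  ≡⟨ cong₂ (λ x y → + x - + y) (X≡Xcap (suc k)) (X≡Xcap k) ⟩
    + Xcap (suc k) - + Xcap k    ≡⟨ [+m]-[+n]≡m⊖n (Xcap (suc k)) (Xcap k) ⟩
    Xcap (suc k) ⊖ Xcap k        ≡⟨ ⊖-≥ (Xcap-≤-Xcap-suc k) ⟩
    + Δ k                        ∎
    where open ≡-Reasoning

  ΔX-later-≤-earlier+1 : ∀ {a a′} → a ≤ a′ → ΔX S σ (suc a′) ≤ℤ ΔX S σ (suc a) + + 1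
  ΔX-later-≤-earlier+1 {a} {a′} a≤a′ rewrite ΔX-suc a | ΔX-suc a′ =
    +≤+ (later-≤-earlier+1 a≤a′)

  ΔX-later-≤-after-jump : ∀ {c a′} → ΔX S σ (suc (suc c)) ≡ ΔX S σ (suc c) + + 1 →
    suc c ≤ a′ → ΔX S σ (suc a′) ≤ℤ ΔX S σ (suc (suc c))
  ΔX-later-≤-after-jump {c} {a′} jump c<a′
    rewrite ΔX-suc (suc c) | ΔX-suc c | ΔX-suc a′ =
    +≤+ (later-≤-after-jump (+-injective jump) c<a′)

proposition2 : (n : ℕ) → 1 ≤ n → (S : Fin n → ℕ × ℕ) → (σ : Permutation′ n) →
    ((k k′ : ℕ) → 1 ≤ k → k ≤ n → 1 ≤ k′ → k′ ≤ n → k < k′ →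
      ΔX S σ k′ ≤ℤ ΔX S σ k + + 1)
    × ((k : ℕ) → 2 ≤ k → k ≤ n →
      ΔX S σ k ≡ ΔX S σ (k ∸ 1) + + 1 →
      (k′ : ℕ) → 1 ≤ k′ → k′ ≤ n → k < k′ →
      ΔX S σ k′ ≤ℤ ΔX S σ k)
proposition2 n _ S σ =
  (λ where
    (suc a) (suc a′) _ _ _ _ (s≤s a<a′) → ΔX-later-≤-earlier+1 S σ (<⇒≤ a<a′)) ,
  (λ where
    (suc zero) (s≤s ())
    (suc (suc c)) _ _ jump (suc a′) _ _ (s≤s 1+c<a′) →
      ΔX-later-≤-after-jump S σ jump (<⇒≤ 1+c<a′))
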